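{- Let $g$ be a non-negative integer. (1) Let $a\geq b\geq 2$. The complete bipartite graph $K_{a,b}$ has an $R_g$-cutset if and only if $g=0$, and $\kappa_0(K_{a,b})=b$. (2) Let $r\geq 3$ and let $1\le n_1\leq n_2\leq \cdots\leq n_r$ be integers with $n_r\ge 2$. The complete multipartite graph $K_{n_1,n_2,\ldots,n_r}$ (with parts of sizes $n_1,\dots,n_r$) has an $R_g$-cutset if and only if $g=0$, and $$\kappa_0(K_{n_1,n_2,\ldots,n_r})=\sum_{i=1}^{r-1}n_i.$$
   Context: A set $S\subseteq V(G)$ is a cutset of $G$ if $G-S$ is not connected. For a non-negative integer $g$, a cutset $S$ is an $R_g$-cutset if every connected component of $G-S$ has at least $g+1$ vertices. If $G$ has an $R_g$-cutset, the $g$-extra connectivity $\kappa_g(G)$ is the minimum cardinality of an $R_g$-cutset of $G$. -}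

module Defs where

open import Data.Nat using (ℕ; zero; suc; _≤_)
open import Data.Fin using (Fin; zero; suc; splitAt)
open import Data.Fin.Subset using (Subset; _∉_; ∣_∣)
open import Data.Vec using (Vec; []; _∷_; sum)
open import Data.Sum using (inj₁; inj₂)
open import Data.Product using (Σ; ∃; _×_; _,_)
open import Relation.Nullary using (¬_)
open import Relation.Binary.PropositionalEquality using (_≡_; _≢_)
open import Function.Definitions using (Injective)

Graph : ℕ → Set₁
Graph N = Fin N → Fin N → Set

data Reach {N : ℕ} (G : Graph N) (S : Subset N) : Fin N → Fin N → Set where
  here : ∀ {u} → u ∉ S → Reach G S u u
  step : ∀ {u v w} → u ∉ S → G u v → Reach G S v w → Reach G S u w

IsCutset : ∀ {N} → Graph N → Subset N → Set
IsCutset {N} G S = Σ (Fin N) λ u → Σ (Fin N) λ v → u ∉ S × v ∉ S × ¬ Reach G S u v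

-- The connected component of G - S containing v has at least k vertices:
-- there are k distinct vertices reachable from v in G - S.
ComponentHasAtLeast : ∀ {N} → Graph N → Subset N → Fin N → ℕ → Set
ComponentHasAtLeast {N} G S v k =
  Σ (Fin k → Fin N) λ f → Injective _≡_ _≡_ f × (∀ i → Reach G S v (f i))

IsRgCutset : ∀ {N} → Graph N → ℕ → Subset N → Set
IsRgCutset {N} G g S = IsCutset G S × (∀ v → v ∉ S → ComponentHasAtLeast G S v (suc g))

HasRgCutset : ∀ {N} → Graph N → ℕ → Set
HasRgCutset {N} G g = ∃ λ (S : Subset N) → IsRgCutset G g S

-- κ_g(G) = k : k is the minimum cardinality of an R_g-cutset of G.
ExtraConnectivity≡ : ∀ {N} → Graph N → ℕ → ℕ → Set
ExtraConnectivity≡ {N} G g k =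
  (∃ λ (S : Subset N) → IsRgCutset G g S × ∣ S ∣ ≡ k)
  × (∀ (S : Subset N) → IsRgCutset G g S → k ≤ ∣ S ∣)

-- Vertices of K_{n_1,...,n_r} are Fin (n_1 + ... + n_r), the first n_1 forming part 1, etc.
partOf : ∀ {r} (ns : Vec ℕ r) → Fin (sum ns) → Fin r
partOf (k ∷ ns) x with splitAt k x
... | inj₁ _ = zero
... | inj₂ y = suc (partOf ns y)

completeMultipartite : ∀ {r} (ns : Vec ℕ r) → Graph (sum ns)
completeMultipartite ns u v = partOf ns u ≢ partOf ns v

completeBipartite : (a b : ℕ) → Graph (sum (a ∷ b ∷ []))
completeBipartite a b = completeMultipartite (a ∷ b ∷ [])

-- In a complete multipartite graph every two vertices in different parts are adjacent, so
-- G − S is disconnected only when all surviving vertices lie in a single part, and then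
-- G − S has no edges at all. Hence every component of G − S is a single vertex (so only
-- g = 0 admits an R_g-cutset), and a cutset keeps at most the largest part, of size n_r:
-- κ₀ = N − n_r, attained by deleting everything outside that part.
module Submission where

open import Defs
open import Data.Nat using (ℕ; suc; _≤_)
open import Data.Fin using (Fin; fromℕ) renaming (_≤_ to _≤ᶠ_)
open import Data.Vec using (Vec; lookup; init; sum)
open import Data.Product using (_×_)
open import Function.Bundles using (_⇔_)
open import Relation.Binary.PropositionalEquality using (_≡_)

open import Data.Nat using (zero; _+_; _∸_; s≤s)
import Data.Nat.Properties as ℕ
open import Data.Fin using (zero; suc; splitAt; _↑ʳ_; _≟_)
import Data.Fin.Properties as Fin
open import Data.Fin.Subset using (Subset; _∈_; _∉_; ∣_∣; ∁; ⊤; ⊥; _⊆_)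
import Data.Fin.Subset.Properties as Subset
open import Data.Vec using ([]; _∷_; _++_)
open import Data.Vec.Properties using (lookup-splitAt; lookup-replicate; []=⇒lookup; lookup⇒[]=)
open import Data.Bool using (true)
open import Data.Sum using (inj₁; inj₂)
open import Data.Product using (Σ; ∃; _,_)
open import Data.Empty using (⊥-elim)
open import Relation.Nullary using (¬_; yes; no; does)
open import Relation.Nullary.Decidable using (dec-true)
open import Relation.Binary.PropositionalEquality using (_≢_; refl; sym; trans; cong; subst; module ≡-Reasoning)
open import Function.Bundles using (mk⇔)

partSubset : ∀ {r} (ns : Vec ℕ r) → Fin r → Subset (sum ns)
partSubset (k ∷ ns) zero    = ⊤ {k} ++ ⊥
partSubset (k ∷ ns) (suc q) = ⊥ {k} ++ partSubset ns q

lookup-partSubset : ∀ {r} (ns : Vec ℕ r) p v →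
  lookup (partSubset ns p) v ≡ does (partOf ns v ≟ p)
lookup-partSubset (k ∷ ns) zero v rewrite lookup-splitAt k (⊤ {k}) (⊥ {sum ns}) v
  with splitAt k v
... | inj₁ i = lookup-replicate i true
... | inj₂ j = lookup-replicate j _
lookup-partSubset (k ∷ ns) (suc q) v rewrite lookup-splitAt k (⊥ {k}) (partSubset ns q) v
  with splitAt k v
... | inj₁ i = lookup-replicate i _
... | inj₂ j = lookup-partSubset ns q j

module _ {r} (ns : Vec ℕ r) {p : Fin r} {v : Fin (sum ns)} where

  ∈-partSubset⁺ : partOf ns v ≡ p → v ∈ partSubset ns p
  ∈-partSubset⁺ e =
    lookup⇒[]= v _ (trans (lookup-partSubset ns p v) (dec-true (partOf ns v ≟ p) e))

  ∈-partSubset⁻ : v ∈ partSubset ns p → partOf ns v ≡ p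
  ∈-partSubset⁻ v∈ with partOf ns v ≟ p | lookup-partSubset ns p v
  ... | yes e | _  = e
  ... | no _  | eq with trans (sym ([]=⇒lookup v∈)) eq
  ...   | ()

∣⊤++p∣≡ : ∀ k {n} (p : Subset n) → ∣ ⊤ {k} ++ p ∣ ≡ k + ∣ p ∣
∣⊤++p∣≡ zero    p = refl
∣⊤++p∣≡ (suc k) p = cong suc (∣⊤++p∣≡ k p)

∣⊥++p∣≡ : ∀ k {n} (p : Subset n) → ∣ ⊥ {k} ++ p ∣ ≡ ∣ p ∣
∣⊥++p∣≡ zero    p = refl
∣⊥++p∣≡ (suc k) p = ∣⊥++p∣≡ k p

∣partSubset∣≡ : ∀ {r} (ns : Vec ℕ r) p → ∣ partSubset ns p ∣ ≡ lookup ns p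
∣partSubset∣≡ (k ∷ ns) zero = begin
  ∣ ⊤ {k} ++ ⊥ ∣      ≡⟨ ∣⊤++p∣≡ k ⊥ ⟩
  k + ∣ ⊥ {sum ns} ∣  ≡⟨ cong (k +_) (Subset.∣⊥∣≡0 (sum ns)) ⟩
  k + 0               ≡⟨ ℕ.+-identityʳ k ⟩
  k                   ∎
  where open ≡-Reasoning
∣partSubset∣≡ (k ∷ ns) (suc q) = trans (∣⊥++p∣≡ k (partSubset ns q)) (∣partSubset∣≡ ns q)

Reach-source∉ : ∀ {N} {G : Graph N} {S u w} → Reach G S u w → u ∉ S
Reach-source∉ (here u∉)     = u∉
Reach-source∉ (step u∉ _ _) = u∉

ComponentHasAtLeast-one : ∀ {N} {G : Graph N} {S v} → v ∉ S → ComponentHasAtLeast G S v 1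
ComponentHasAtLeast-one {v = v} v∉ = (λ _ → v) , (λ { {zero} {zero} _ → refl }) , (λ _ → here v∉)

module _ {r} (ns : Vec ℕ r) where

  private
    K = completeMultipartite ns

  InsidePart : Subset (sum ns) → Fin r → Set
  InsidePart S p = ∀ w → w ∉ S → partOf ns w ≡ p

  InsidePart⇒Reach⇒≡ : ∀ {S p u w} → InsidePart S p → Reach K S u w → u ≡ w
  InsidePart⇒Reach⇒≡ inside (here _) = refl
  InsidePart⇒Reach⇒≡ inside (step {u} {v} u∉ uv rch) =
    ⊥-elim (uv (trans (inside u u∉) (sym (inside v (Reach-source∉ rch)))))

  Reach-via-other-part : ∀ {S u v w} → u ∉ S → v ∉ S → w ∉ S →
    partOf ns w ≢ partOf ns u → Reach K S u v
  Reach-via-other-part {u = u} {v = v} u∉ v∉ w∉ wu with partOf ns v ≟ partOf ns u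
  ... | no vu  = step u∉ (λ uv → vu (sym uv)) (here v∉)
  ... | yes vu = step u∉ (λ uw → wu (sym uw)) (step w∉ (λ wv → wu (trans wv vu)) (here v∉))

  IsCutset⇒InsidePart : ∀ {S} → IsCutset K S → ∃ (InsidePart S)
  IsCutset⇒InsidePart (u , v , u∉ , v∉ , ¬uv) = partOf ns u , inside
    where
    inside : InsidePart _ (partOf ns u)
    inside w w∉ with partOf ns w ≟ partOf ns u
    ... | yes wu = wu
    ... | no  wu = ⊥-elim (¬uv (Reach-via-other-part u∉ v∉ w∉ wu))

  InsidePart⇒∣S∣≥ : ∀ {S p} → InsidePart S p → sum ns ∸ lookup ns p ≤ ∣ S ∣
  InsidePart⇒∣S∣≥ {S} {p} inside = begin
    sum ns ∸ lookup ns p         ≤⟨ ℕ.∸-monoʳ-≤ (sum ns) ∣∁S∣≤ ⟩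
    sum ns ∸ ∣ ∁ S ∣             ≡⟨ cong (sum ns ∸_) (Subset.∣∁p∣≡n∸∣p∣ S) ⟩
    sum ns ∸ (sum ns ∸ ∣ S ∣)    ≡⟨ ℕ.m∸[m∸n]≡n (Subset.∣p∣≤n S) ⟩
    ∣ S ∣                        ∎
    where
    open ℕ.≤-Reasoning
    ∁S⊆part : ∁ S ⊆ partSubset ns p
    ∁S⊆part {w} w∈ = ∈-partSubset⁺ ns (inside w (Subset.x∈∁p⇒x∉p w∈))
    ∣∁S∣≤ : ∣ ∁ S ∣ ≤ lookup ns p
    ∣∁S∣≤ = subst (∣ ∁ S ∣ ≤_) (∣partSubset∣≡ ns p) (Subset.p⊆q⇒∣p∣≤∣q∣ ∁S⊆part)

  ¬HasRgCutset-suc : ∀ g → ¬ HasRgCutset K (suc g)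
  ¬HasRgCutset-suc g (S , cut@(u , _ , u∉ , _) , components)
    with IsCutset⇒InsidePart cut | components u u∉
  ... | _ , inside | f , f-injective , reaches =
    Fin.0≢1+n (f-injective (trans (sym (u≡f zero)) (u≡f (suc zero))))
    where
    u≡f : ∀ i → u ≡ f i
    u≡f i = InsidePart⇒Reach⇒≡ inside (reaches i)

part-has-two-vertices : ∀ {r} (ns : Vec ℕ r) p → 2 ≤ lookup ns p →
  Σ (Fin (sum ns)) λ v₁ → Σ (Fin (sum ns)) λ v₂ →
    v₁ ≢ v₂ × partOf ns v₁ ≡ p × partOf ns v₂ ≡ p
part-has-two-vertices (0 ∷ ns)           zero ()
part-has-two-vertices (1 ∷ ns)           zero (s≤s ())
part-has-two-vertices (suc (suc k) ∷ ns) zero _ = zero , suc zero , (λ ()) , refl , refl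
part-has-two-vertices (k ∷ ns) (suc q) 2≤
  with part-has-two-vertices ns q 2≤
... | v₁ , v₂ , v₁≢v₂ , v₁∈q , v₂∈q =
  k ↑ʳ v₁ , k ↑ʳ v₂ , (λ e → v₁≢v₂ (Fin.↑ʳ-injective k v₁ v₂ e)) , shift v₁ v₁∈q , shift v₂ v₂∈q
  where
  shift : ∀ v → partOf ns v ≡ q → partOf (k ∷ ns) (k ↑ʳ v) ≡ suc q
  shift v e rewrite Fin.splitAt-↑ʳ k (sum ns) v = cong suc e

module _ {r} (ns : Vec ℕ r) (p : Fin r) (2≤p : 2 ≤ lookup ns p) where

  private
    K = completeMultipartite ns
    S₀ = ∁ (partSubset ns p)

  InsidePart-∁partSubset : InsidePart ns S₀ p
  InsidePart-∁partSubset w w∉ = ∈-partSubset⁻ ns (Subset.x∉∁p⇒x∈p w∉)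

  ∁partSubset-isR0Cutset : IsRgCutset K 0 S₀
  ∁partSubset-isR0Cutset with part-has-two-vertices ns p 2≤p
  ... | v₁ , v₂ , v₁≢v₂ , v₁∈p , v₂∈p =
    (v₁ , v₂ , ∉S₀ v₁∈p , ∉S₀ v₂∈p ,
      λ rch → v₁≢v₂ (InsidePart⇒Reach⇒≡ ns InsidePart-∁partSubset rch)) ,
    λ _ → ComponentHasAtLeast-one
    where
    ∉S₀ : ∀ {w} → partOf ns w ≡ p → w ∉ S₀
    ∉S₀ e = Subset.x∈p⇒x∉∁p (∈-partSubset⁺ ns e)

  HasRgCutset⇔≡0 : ∀ g → HasRgCutset K g ⇔ g ≡ 0
  HasRgCutset⇔≡0 _ = mk⇔ to from
    where
    to : ∀ {g} → HasRgCutset K g → g ≡ 0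
    to {zero}  _   = refl
    to {suc g} has = ⊥-elim (¬HasRgCutset-suc ns g has)
    from : ∀ {g} → g ≡ 0 → HasRgCutset K g
    from refl = S₀ , ∁partSubset-isR0Cutset

  extraConnectivity₀ : (∀ i → lookup ns i ≤ lookup ns p) →
    ExtraConnectivity≡ K 0 (sum ns ∸ lookup ns p)
  extraConnectivity₀ largest = (S₀ , ∁partSubset-isR0Cutset , ∣S₀∣≡) , minimal
    where
    ∣S₀∣≡ : ∣ S₀ ∣ ≡ sum ns ∸ lookup ns p
    ∣S₀∣≡ = trans (Subset.∣∁p∣≡n∸∣p∣ (partSubset ns p)) (cong (sum ns ∸_) (∣partSubset∣≡ ns p))
    minimal : ∀ S → IsRgCutset K 0 S → sum ns ∸ lookup ns p ≤ ∣ S ∣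
    minimal S (cut , _) with IsCutset⇒InsidePart ns cut
    ... | q , inside = ℕ.≤-trans (ℕ.∸-monoʳ-≤ (sum ns) (largest q)) (InsidePart⇒∣S∣≥ ns inside)

sum-init+last : ∀ m (ns : Vec ℕ (suc m)) → sum (init ns) + lookup ns (fromℕ m) ≡ sum ns
sum-init+last zero    (x ∷ [])     = sym (ℕ.+-identityʳ x)
sum-init+last (suc m) (x ∷ y ∷ ns) = begin
  x + sum (init (y ∷ ns)) + lookup (y ∷ ns) (fromℕ m)   ≡⟨ ℕ.+-assoc x _ _ ⟩
  x + (sum (init (y ∷ ns)) + lookup (y ∷ ns) (fromℕ m)) ≡⟨ cong (x +_) (sum-init+last m (y ∷ ns)) ⟩
  x + sum (y ∷ ns)                                      ∎
  where open ≡-Reasoning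

completeBipartite-extraConnectivity : (a b : ℕ) → b ≤ a → 2 ≤ b →
  (∀ g → HasRgCutset (completeBipartite a b) g ⇔ g ≡ 0)
  × ExtraConnectivity≡ (completeBipartite a b) 0 b
completeBipartite-extraConnectivity a b b≤a 2≤b =
  HasRgCutset⇔≡0 (a ∷ b ∷ []) zero 2≤a ,
  subst (ExtraConnectivity≡ (completeBipartite a b) 0) a+b∸a≡b
    (extraConnectivity₀ (a ∷ b ∷ []) zero 2≤a λ { zero → ℕ.≤-refl ; (suc zero) → b≤a })
  where
  2≤a : 2 ≤ a
  2≤a = ℕ.≤-trans 2≤b b≤a
  a+b∸a≡b : a + (b + 0) ∸ a ≡ b
  a+b∸a≡b = trans (ℕ.m+n∸m≡n a (b + 0)) (ℕ.+-identityʳ b)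

completeMultipartite-extraConnectivity : ∀ m (ns : Vec ℕ (suc m)) →
  (∀ i j → i ≤ᶠ j → lookup ns i ≤ lookup ns j) → 2 ≤ lookup ns (fromℕ m) →
  (∀ g → HasRgCutset (completeMultipartite ns) g ⇔ g ≡ 0)
  × ExtraConnectivity≡ (completeMultipartite ns) 0 (sum (init ns))
completeMultipartite-extraConnectivity m ns sorted 2≤last =
  HasRgCutset⇔≡0 ns (fromℕ m) 2≤last ,
  subst (ExtraConnectivity≡ (completeMultipartite ns) 0) sum∸last≡sum-init
    (extraConnectivity₀ ns (fromℕ m) 2≤last λ i → sorted i (fromℕ m) (Fin.≤fromℕ i))
  where
  sum∸last≡sum-init : sum ns ∸ lookup ns (fromℕ m) ≡ sum (init ns)
  sum∸last≡sum-init = trans (cong (_∸ lookup ns (fromℕ m)) (sym (sum-init+last m ns)))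
                            (ℕ.m+n∸n≡m (sum (init ns)) (lookup ns (fromℕ m)))

proposition2p2 : ((a b : ℕ) → b ≤ a → 2 ≤ b →
    (∀ (g : ℕ) → HasRgCutset (completeBipartite a b) g ⇔ (g ≡ 0))
    × ExtraConnectivity≡ (completeBipartite a b) 0 b)
    × ((m : ℕ) → 2 ≤ m → (ns : Vec ℕ (suc m)) →
    (∀ i → 1 ≤ lookup ns i) →
    (∀ i j → i ≤ᶠ j → lookup ns i ≤ lookup ns j) →
    2 ≤ lookup ns (fromℕ m) →
    (∀ (g : ℕ) → HasRgCutset (completeMultipartite ns) g ⇔ (g ≡ 0))
    × ExtraConnectivity≡ (completeMultipartite ns) 0 (sum (init ns)))
proposition2p2 =
  completeBipartite-extraConnectivity ,
  λ m _ ns _ → completeMultipartite-extraConnectivity m ns
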